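{- Let $n>2$ and let $\pi\in S_n$ satisfy $\max_{\sigma\in\pi C_n}\operatorname{cyc}(\sigma)=2$. Then every $\sigma\in\pi C_n$ has cycle type $(n-1,1)$, i.e., consists of one fixed point and one cycle of length $n-1$.
   Context: $c=(1,2,\ldots,n)\in S_n$ is the $n$-cycle, $C_n=\langle c\rangle$ the cyclic subgroup it generates, and $\pi C_n=\{\pi c^j : j\in\mathbb{Z}\}$. For $\sigma\in S_n$, $\operatorname{cyc}(\sigma)$ denotes the number of cycles of $\sigma$, fixed points counted as cycles of length 1. -}

module Defs where

open import Data.Nat using (ℕ; zero; suc; _≤ᵇ_; _∸_)
import Data.Nat as ℕ
open import Data.Fin using (Fin; zero; suc; toℕ; lower₁; _≟_)
open import Data.List using (List; map; upTo)
open import Data.List.Base using (allFin)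
open import Data.Bool.ListAction using (all; any)
open import Data.Nat.ListAction using (sum)
open import Data.Fin.Permutation using (Permutation′; _⟨$⟩ʳ_)
open import Data.Product using (Σ; _×_)
open import Relation.Binary.PropositionalEquality using (_≡_)
open import Relation.Nullary using (¬_)
open import Data.Bool using (Bool; if_then_else_)
open import Relation.Nullary using (yes; no)
open import Relation.Nullary.Decidable using (⌊_⌋)

iter : ∀ {A : Set} → ℕ → (A → A) → A → A
iter zero    f x = x
iter (suc k) f x = f (iter k f x)

-- the n-cycle c = (1 2 … n), on Fin n written as i ↦ i+1 (mod n)
cycleC : ∀ {n} → Fin n → Fin n
cycleC {suc m} i with m ℕ.≟ toℕ i
... | yes _ = zero
... | no ne = suc (lower₁ i ne)

cPow : ∀ {n} → ℕ → Fin n → Fin n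
cPow j = iter j cycleC

-- the element π c^j of the coset π C_n (σ(i) = π(c^j(i)))
coset : ∀ {n} → Permutation′ n → ℕ → Fin n → Fin n
coset π j i = π ⟨$⟩ʳ cPow j i

-- orbit of i under f: the list f^0 i, …, f^(n-1) i (for a permutation of Fin n
-- this lists every element of the cycle containing i)
orbit : ∀ {n} → (Fin n → Fin n) → Fin n → List (Fin n)
orbit {n} f i = map (λ k → iter k f i) (upTo n)

inOrbit : ∀ {n} → (Fin n → Fin n) → Fin n → Fin n → Bool
inOrbit f i x = any (λ y → ⌊ x ≟ y ⌋) (orbit f i)

isCycleMin : ∀ {n} → (Fin n → Fin n) → Fin n → Bool
isCycleMin f i = all (λ y → toℕ i ≤ᵇ toℕ y) (orbit f i)

-- cyc σ: number of cycles (fixed points included) = number of cycle minima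
cyc : ∀ {n} → (Fin n → Fin n) → ℕ
cyc {n} f = sum (map (λ i → if isCycleMin f i then 1 else 0) (allFin n))

cycleLength : ∀ {n} → (Fin n → Fin n) → Fin n → ℕ
cycleLength {n} f i = sum (map (λ x → if inOrbit f i x then 1 else 0) (allFin n))

CycleType[n-1,1] : ∀ {n} → (Fin n → Fin n) → Set
CycleType[n-1,1] {n} f =
  Σ (Fin n) λ p → (f p ≡ p) × (∀ y → ¬ (y ≡ p) → cycleLength f y ≡ n ∸ 1)

-- Since c acts transitively, every point i is fixed by π c^k(i) for some k(i) < n. If some π c^k
-- had two fixed points p ≠ q, then p, q and any third point would lie on three different cycles,
-- contradicting cyc ≤ 2; so k is injective on Fin n, hence surjective, and every π c^j (j taken
-- mod n) has a fixed point p. A fixed point and at most two cycles force the other n − 1 points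
-- onto a single cycle.
{-# OPTIONS --safe #-}
module Submission where

open import Defs
import Data.Nat as ℕ
open import Data.Nat using (ℕ; zero; suc; _+_; _*_; _∸_; _<_; _≤_; NonZero; >-nonZero; _/_; _%_; s≤s; s≤s⁻¹)
open import Data.Nat.Properties
  using (+-comm; n<1+n; m<n⇒m<1+n; m∸n≤m; m<n⇒0<n∸m; m∸n+n≡m; <⇒≤; ≤-trans; <-≤-trans; <-irrefl; ≤⇒≯; ≤-totalOrder; ≤⇒≤ᵇ;
         suc-injective; 0≢1+n; m≤m+n; m≤n+m; +-monoʳ-≤; +-0-commutativeMonoid; module ≤-Reasoning)
open import Data.Nat.DivMod using (m≡m%n+[m/n]*n; m%n<n)
open import Data.Nat.ListAction using (sum)
open import Algebra.Properties.CommutativeMonoid.Sum +-0-commutativeMonoid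
  using (sum-remove; sum-cong-≗) renaming (sum to ∑)
open import Data.Bool using (Bool; true; false; T; if_then_else_)
open import Data.Fin using (Fin; zero; suc; toℕ; fromℕ<; punchIn; punchOut; _≟_)
open import Data.Fin.Properties
  using (pigeonhole; toℕ<n; toℕ-injective; toℕ-lower₁; toℕ-fromℕ<; injective⇒≤; any?;
         punchIn-punchOut; punchIn-injective; punchOut-injective; punchInᵢ≢i)
open import Data.Fin.Permutation using (Permutation′; _⟨$⟩ʳ_; _⟨$⟩ˡ_; inverseʳ)
open import Data.Vec.Functional using (removeAt)
open import Data.List using (map; tabulate; allFin)
open import Data.List.Properties using (map-tabulate)
open import Data.List.Membership.Propositional using (_∈_)
open import Data.List.Membership.Propositional.Properties using (∈-map⁺; ∈-map⁻; ∈-upTo⁺)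
open import Data.List.Relation.Unary.Any as Any using ()
open import Data.List.Relation.Unary.Any.Properties using (any⁺; any⁻)
open import Data.List.Relation.Unary.All as All using ()
open import Data.List.Relation.Unary.All.Properties using (all⁻)
open import Data.List.Extrema ≤-totalOrder using (argmin; argmin-sel; f[argmin]≤f[xs])
open import Data.Empty using (⊥-elim)
open import Data.Product using (Σ; ∃-syntax; _×_; _,_; proj₁; proj₂)
open import Data.Sum using (_⊎_; inj₁; inj₂; [_,_]′)
open import Function using (_∘_; id)
open import Function.Bundles using (Injection)
open import Function.Definitions using (Injective)
open import Function.Properties.Inverse using (↔⇒↣)
open import Relation.Binary.PropositionalEquality
  using (_≡_; _≢_; refl; sym; trans; cong; cong₂; subst; module ≡-Reasoning)
open import Relation.Nullary using (¬_; yes; no)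
open import Relation.Nullary.Decidable using (T?; toWitness; fromWitness; decidable-stable)

module _ {A : Set} (f : A → A) where

  iter-+ : ∀ m n x → iter (m + n) f x ≡ iter m f (iter n f x)
  iter-+ zero    n x = refl
  iter-+ (suc m) n x = cong f (iter-+ m n x)

  iter-comm : ∀ m n x → iter m f (iter n f x) ≡ iter n f (iter m f x)
  iter-comm m n x = begin
    iter m f (iter n f x) ≡⟨ iter-+ m n x ⟨
    iter (m + n) f x      ≡⟨ cong (λ k → iter k f x) (+-comm m n) ⟩
    iter (n + m) f x      ≡⟨ iter-+ n m x ⟩
    iter n f (iter m f x) ∎
    where open ≡-Reasoning

  iter-*-period : ∀ {d x} → iter d f x ≡ x → ∀ q → iter (q * d) f x ≡ x
  iter-*-period             xᵈ≡x zero    = refl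
  iter-*-period {d} {x} xᵈ≡x (suc q) = begin
    iter (d + q * d) f x        ≡⟨ iter-+ d (q * d) x ⟩
    iter d f (iter (q * d) f x) ≡⟨ cong (iter d f) (iter-*-period xᵈ≡x q) ⟩
    iter d f x                  ≡⟨ xᵈ≡x ⟩
    x                           ∎
    where open ≡-Reasoning

  iter-%-period : ∀ {d x} .{{_ : NonZero d}} → iter d f x ≡ x →
                  ∀ k → iter k f x ≡ iter (k % d) f x
  iter-%-period {d} {x} xᵈ≡x k = begin
    iter k f x                              ≡⟨ cong (λ m → iter m f x) (m≡m%n+[m/n]*n k d) ⟩
    iter (k % d + (k / d) * d) f x          ≡⟨ iter-+ (k % d) ((k / d) * d) x ⟩
    iter (k % d) f (iter ((k / d) * d) f x) ≡⟨ cong (iter (k % d) f) (iter-*-period xᵈ≡x (k / d)) ⟩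
    iter (k % d) f x                        ∎
    where open ≡-Reasoning

  iter-injective : Injective _≡_ _≡_ f → ∀ k → Injective _≡_ _≡_ (iter k f)
  iter-injective f-injective zero    eq = eq
  iter-injective f-injective (suc k) eq = iter-injective f-injective k (f-injective eq)

Reaches : ∀ {A : Set} → (A → A) → A → A → Set
Reaches f x y = ∃[ k ] iter k f x ≡ y

module _ {A : Set} {f : A → A} where

  reaches-refl : ∀ {x} → Reaches f x x
  reaches-refl = 0 , refl

  reaches-trans : ∀ {x y z} → Reaches f x y → Reaches f y z → Reaches f x z
  reaches-trans {x} (k , refl) (m , refl) = m + k , iter-+ f m k x

  fixedPoint-reaches : ∀ {p y} → f p ≡ p → Reaches f p y → y ≡ p
  fixedPoint-reaches fp (zero  , refl) = refl
  fixedPoint-reaches fp (suc k , refl) = trans (cong f (fixedPoint-reaches fp (k , refl))) fp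

sum-tabulate : ∀ {n} (h : Fin n → ℕ) → sum (tabulate h) ≡ ∑ h
sum-tabulate {zero}  h = refl
sum-tabulate {suc n} h = cong (h zero +_) (sum-tabulate (h ∘ suc))

sum-map-allFin : ∀ {n} (h : Fin n → ℕ) → sum (map h (allFin n)) ≡ ∑ h
sum-map-allFin h = trans (cong sum (map-tabulate id h)) (sum-tabulate h)

∑-const-1 : ∀ n → ∑ {n} (λ _ → 1) ≡ n
∑-const-1 zero    = refl
∑-const-1 (suc n) = cong suc (∑-const-1 n)

entry≤∑ : ∀ {n} (h : Fin n → ℕ) i → h i ≤ ∑ h
entry≤∑ h zero    = m≤m+n _ _
entry≤∑ h (suc i) = ≤-trans (entry≤∑ (h ∘ suc) i) (m≤n+m _ _)

removeAt-punchOut : ∀ {n} {A : Set} (h : Fin (suc n) → A) {i j} (i≢j : i ≢ j) →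
                    removeAt h i (punchOut i≢j) ≡ h j
removeAt-punchOut h i≢j = cong h (punchIn-punchOut i≢j)

pair≤∑ : ∀ {n} (h : Fin n → ℕ) {a b} → a ≢ b → h a + h b ≤ ∑ h
pair≤∑ {suc n} h {a} {b} a≢b = begin
  h a + h b                         ≡⟨ cong (h a +_) (removeAt-punchOut h a≢b) ⟨
  h a + removeAt h a (punchOut a≢b) ≤⟨ +-monoʳ-≤ (h a) (entry≤∑ (removeAt h a) _) ⟩
  h a + ∑ (removeAt h a)            ≡⟨ sum-remove h ⟨
  ∑ h                               ∎
  where open ≤-Reasoning

triple≤∑ : ∀ {n} (h : Fin n → ℕ) {a b c} → a ≢ b → a ≢ c → b ≢ c → h a + (h b + h c) ≤ ∑ h
triple≤∑ {suc n} h {a} {b} {c} a≢b a≢c b≢c = begin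
  h a + (h b + h c)     ≡⟨ cong (h a +_) (cong₂ _+_ (removeAt-punchOut h a≢b) (removeAt-punchOut h a≢c)) ⟨
  h a + (h′ b′ + h′ c′) ≤⟨ +-monoʳ-≤ (h a) (pair≤∑ h′ (b≢c ∘ punchOut-injective a≢b a≢c)) ⟩
  h a + ∑ h′            ≡⟨ sum-remove h ⟨
  ∑ h                   ∎
  where
  open ≤-Reasoning
  h′ : Fin n → ℕ
  h′ = removeAt h a
  b′ c′ : Fin n
  b′ = punchOut a≢b
  c′ = punchOut a≢c

∑-indicator-except : ∀ {n} (h : Fin n → ℕ) p → h p ≡ 0 → (∀ i → i ≢ p → h i ≡ 1) →
                     ∑ h ≡ n ∸ 1
∑-indicator-except {suc n} h p hp≡0 hi≡1 = begin
  ∑ h                    ≡⟨ sum-remove h ⟩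
  h p + ∑ (removeAt h p) ≡⟨ cong₂ _+_ hp≡0 (sum-cong-≗ (λ i → hi≡1 (punchIn p i) (punchInᵢ≢i p i))) ⟩
  ∑ {n} (λ _ → 1)        ≡⟨ ∑-const-1 n ⟩
  n                      ∎
  where open ≡-Reasoning

𝟙 : Bool → ℕ
𝟙 b = if b then 1 else 0

𝟙-T : ∀ {b} → T b → 𝟙 b ≡ 1
𝟙-T {true} _ = refl

𝟙-¬T : ∀ {b} → ¬ T b → 𝟙 b ≡ 0
𝟙-¬T {false} _  = refl
𝟙-¬T {true}  ¬t = ⊥-elim (¬t _)

third-point : ∀ {n} → 2 < n → {p q : Fin n} → p ≢ q → ∃[ r ] r ≢ p × r ≢ q
third-point {suc (suc (suc n))} (s≤s (s≤s (s≤s _))) {p} {q} p≢q = punchIn p r′ , punchInᵢ≢i p r′ , r≢q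
  where
  q′ r′ : Fin (suc (suc n))
  q′ = punchOut p≢q
  r′ = punchIn q′ zero
  r≢q : punchIn p r′ ≢ q
  r≢q r≡q = punchInᵢ≢i q′ zero (punchIn-injective p r′ q′ (trans r≡q (sym (punchIn-punchOut p≢q))))

injective⇒surjective : ∀ {n} {g : Fin n → Fin n} → Injective _≡_ _≡_ g → ∀ t → ∃[ i ] g i ≡ t
injective⇒surjective {suc m} {g} g-injective t with any? (λ i → g i ≟ t)
... | yes hit = hit
... | no miss = ⊥-elim (<-irrefl refl (injective⇒≤ g′-injective))
  where
  g′ : Fin (suc m) → Fin m
  g′ i = punchOut {i = t} {j = g i} (miss ∘ (i ,_) ∘ sym)
  g′-injective : Injective _≡_ _≡_ g′
  g′-injective {x} {y} = g-injective ∘ punchOut-injective (miss ∘ (x ,_) ∘ sym) (miss ∘ (y ,_) ∘ sym)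

module _ {n} {f : Fin n → Fin n} (f-injective : Injective _≡_ _≡_ f) where

  period : ∀ x → ∃[ d ] 0 < d × d ≤ n × iter d f x ≡ x
  period x with pigeonhole (n<1+n n) (λ (i : Fin (suc n)) → iter (toℕ i) f x)
  ... | i , j , i<j , xⁱ≡xʲ = d , m<n⇒0<n∸m i<j , d≤n , iter-injective f f-injective (toℕ i) xⁱ⁺ᵈ≡xⁱ
    where
    d : ℕ
    d = toℕ j ∸ toℕ i
    d≤n : d ≤ n
    d≤n = ≤-trans (m∸n≤m (toℕ j) (toℕ i)) (s≤s⁻¹ (toℕ<n j))
    xⁱ⁺ᵈ≡xⁱ : iter (toℕ i) f (iter d f x) ≡ iter (toℕ i) f x
    xⁱ⁺ᵈ≡xⁱ = begin
      iter (toℕ i) f (iter d f x) ≡⟨ iter-comm f (toℕ i) d x ⟩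
      iter d f (iter (toℕ i) f x) ≡⟨ iter-+ f d (toℕ i) x ⟨
      iter (d + toℕ i) f x        ≡⟨ cong (λ k → iter k f x) (m∸n+n≡m (<⇒≤ i<j)) ⟩
      iter (toℕ j) f x            ≡⟨ xⁱ≡xʲ ⟨
      iter (toℕ i) f x            ∎
      where open ≡-Reasoning

  reaches-bounded : ∀ {x y} → Reaches f x y → ∃[ k ] k < n × iter k f x ≡ y
  reaches-bounded {x} (k , xᵏ≡y) with period x
  ... | d , 0<d , d≤n , xᵈ≡x = k % d , <-≤-trans (m%n<n k d) d≤n , trans (sym (iter-%-period f xᵈ≡x k)) xᵏ≡y
    where
    instance
      d≢0 : NonZero d
      d≢0 = >-nonZero 0<d

  reaches-sym : ∀ {x y} → Reaches f x y → Reaches f y x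
  reaches-sym {x} (k , refl) with period x
  ... | d , 0<d , _ , xᵈ≡x = d ∸ r , (begin
      iter (d ∸ r) f (iter k f x) ≡⟨ cong (iter (d ∸ r) f) (iter-%-period f xᵈ≡x k) ⟩
      iter (d ∸ r) f (iter r f x) ≡⟨ iter-+ f (d ∸ r) r x ⟨
      iter (d ∸ r + r) f x        ≡⟨ cong (λ m → iter m f x) (m∸n+n≡m (<⇒≤ (m%n<n k d))) ⟩
      iter d f x                  ≡⟨ xᵈ≡x ⟩
      x                           ∎)
    where
    open ≡-Reasoning
    instance
      d≢0 : NonZero d
      d≢0 = >-nonZero 0<d
    r : ℕ
    r = k % d

  ∈-orbit⁺ : ∀ {x y} → Reaches f x y → y ∈ orbit f x
  ∈-orbit⁺ {x} x↝y with reaches-bounded x↝y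
  ... | k , k<n , refl = ∈-map⁺ (λ k → iter k f x) (∈-upTo⁺ k<n)

  ∈-orbit⁻ : ∀ {x y} → y ∈ orbit f x → Reaches f x y
  ∈-orbit⁻ {x} y∈orbit with ∈-map⁻ (λ k → iter k f x) y∈orbit
  ... | k , _ , y≡xᵏ = k , sym y≡xᵏ

  inOrbit⁺ : ∀ {x y} → Reaches f x y → T (inOrbit f x y)
  inOrbit⁺ = any⁺ _ ∘ Any.map fromWitness ∘ ∈-orbit⁺

  inOrbit⁻ : ∀ {x y} → T (inOrbit f x y) → Reaches f x y
  inOrbit⁻ {x} = ∈-orbit⁻ ∘ Any.map toWitness ∘ any⁻ _ (orbit f x)

  cycleMin : Fin n → Fin n
  cycleMin x = argmin toℕ x (orbit f x)

  reaches-cycleMin : ∀ x → Reaches f x (cycleMin x)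
  reaches-cycleMin x =
    [ (λ m≡x → subst (Reaches f x) (sym m≡x) reaches-refl) , ∈-orbit⁻ ]′ (argmin-sel toℕ x (orbit f x))

  isCycleMin-cycleMin : ∀ x → T (isCycleMin f (cycleMin x))
  isCycleMin-cycleMin x =
    all⁻ _ (All.tabulate (≤⇒≤ᵇ ∘ minimal ∘ ∈-orbit⁺ ∘ reaches-trans (reaches-cycleMin x) ∘ ∈-orbit⁻))
    where
    minimal : ∀ {y} → y ∈ orbit f x → toℕ (cycleMin x) ≤ toℕ y
    minimal = All.lookup (f[argmin]≤f[xs] x (orbit f x))

  cycleMin-≢ : ∀ {x y} → ¬ Reaches f x y → cycleMin x ≢ cycleMin y
  cycleMin-≢ {x} {y} x↛y mx≡my =
    x↛y (reaches-trans (reaches-cycleMin x) (reaches-sym (subst (Reaches f y) (sym mx≡my) (reaches-cycleMin y))))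

  3≤cyc : ∀ {x y z} → ¬ Reaches f x y → ¬ Reaches f x z → ¬ Reaches f y z → 3 ≤ cyc f
  3≤cyc {x} {y} {z} x↛y x↛z y↛z = begin
    1 + (1 + 1)                                        ≡⟨ cong₂ _+_ (counted x) (cong₂ _+_ (counted y) (counted z)) ⟨
    h (cycleMin x) + (h (cycleMin y) + h (cycleMin z)) ≤⟨ triple≤∑ h (cycleMin-≢ x↛y) (cycleMin-≢ x↛z) (cycleMin-≢ y↛z) ⟩
    ∑ h                                                ≡⟨ sum-map-allFin h ⟨
    cyc f                                              ∎
    where
    open ≤-Reasoning
    h : Fin n → ℕ
    h = 𝟙 ∘ isCycleMin f
    counted : ∀ u → h (cycleMin u) ≡ 1
    counted u = 𝟙-T (isCycleMin-cycleMin u)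

  module _ (cyc≤2 : cyc f ≤ 2) where

    private
      fixedPoint-isolated : ∀ {p y} → f p ≡ p → y ≢ p → ¬ Reaches f p y
      fixedPoint-isolated fp y≢p = y≢p ∘ fixedPoint-reaches fp

    fixedPoint-unique : 2 < n → ∀ {p q} → f p ≡ p → f q ≡ q → p ≡ q
    fixedPoint-unique 2<n {p} {q} fp fq = decidable-stable (p ≟ q) λ p≢q →
      let r , r≢p , r≢q = third-point 2<n p≢q
      in ≤⇒≯ cyc≤2 (3≤cyc (fixedPoint-isolated fp (p≢q ∘ sym)) (fixedPoint-isolated fp r≢p)
                          (fixedPoint-isolated fq r≢q))

    fixedPoint⇒cycleType : ∀ {p} → f p ≡ p → CycleType[n-1,1] f
    fixedPoint⇒cycleType {p} fp = p , fp , cycleLength≡n∸1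
      where
      cycleLength≡n∸1 : ∀ y → y ≢ p → cycleLength f y ≡ n ∸ 1
      cycleLength≡n∸1 y y≢p = trans (sum-map-allFin h) (∑-indicator-except h p (𝟙-¬T y↛p) (λ x → 𝟙-T ∘ y∼x x))
        where
        h : Fin n → ℕ
        h = 𝟙 ∘ inOrbit f y
        y↛p : ¬ T (inOrbit f y p)
        y↛p = fixedPoint-isolated fp y≢p ∘ reaches-sym ∘ inOrbit⁻
        y∼x : ∀ x → x ≢ p → T (inOrbit f y x)
        y∼x x x≢p = decidable-stable (T? _) λ y≁x →
          ≤⇒≯ cyc≤2 (3≤cyc (fixedPoint-isolated fp y≢p) (fixedPoint-isolated fp x≢p) (y≁x ∘ inOrbit⁺))

cycleC-cases : ∀ {m} (i : Fin (suc m)) → (toℕ i ≡ m × cycleC i ≡ zero) ⊎ toℕ (cycleC i) ≡ suc (toℕ i)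
cycleC-cases {m} i with m ℕ.≟ toℕ i
... | yes m≡i = inj₁ (sym m≡i , refl)
... | no  m≢i = inj₂ (cong suc (toℕ-lower₁ i m≢i))

cycleC-injective : ∀ {n} → Injective _≡_ _≡_ (cycleC {n})
cycleC-injective {suc m} {x} {y} cx≡cy with cycleC-cases x | cycleC-cases y
... | inj₁ (x≡m , _)  | inj₁ (y≡m , _)  = toℕ-injective (trans x≡m (sym y≡m))
... | inj₁ (_ , cx≡0) | inj₂ cy≡1+y     = ⊥-elim (0≢1+n (trans (cong toℕ (trans (sym cx≡0) cx≡cy)) cy≡1+y))
... | inj₂ cx≡1+x     | inj₁ (_ , cy≡0) = ⊥-elim (0≢1+n (trans (cong toℕ (trans (sym cy≡0) (sym cx≡cy))) cx≡1+x))
... | inj₂ cx≡1+x     | inj₂ cy≡1+y     =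
  toℕ-injective (suc-injective (trans (sym cx≡1+x) (trans (cong toℕ cx≡cy) cy≡1+y)))

toℕ-cPow-zero : ∀ {m} k → k < suc m → toℕ (cPow {suc m} k zero) ≡ k
toℕ-cPow-zero zero    _          = refl
toℕ-cPow-zero (suc k) (s≤s k<m) with cycleC-cases (cPow k zero) | toℕ-cPow-zero k (m<n⇒m<1+n k<m)
... | inj₁ (cᵏ≡m , _) | cᵏ≡k = ⊥-elim (<-irrefl (trans (sym cᵏ≡k) cᵏ≡m) k<m)
... | inj₂ c¹⁺ᵏ≡1+cᵏ  | cᵏ≡k = trans c¹⁺ᵏ≡1+cᵏ (cong suc cᵏ≡k)

cPow-toℕ-zero : ∀ {m} (i : Fin (suc m)) → cPow (toℕ i) zero ≡ i
cPow-toℕ-zero i = toℕ-injective (toℕ-cPow-zero (toℕ i) (toℕ<n i))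

cycleC-reaches : ∀ {m} (i t : Fin (suc m)) → Reaches cycleC i t
cycleC-reaches i t =
  reaches-trans (reaches-sym cycleC-injective (toℕ i , cPow-toℕ-zero i)) (toℕ t , cPow-toℕ-zero t)

cPow-n : ∀ {m} (i : Fin (suc m)) → cPow (suc m) i ≡ i
cPow-n {m} i = begin
  cPow (suc m) i                   ≡⟨ cong (cPow (suc m)) (cPow-toℕ-zero i) ⟨
  cPow (suc m) (cPow (toℕ i) zero) ≡⟨ iter-comm cycleC (suc m) (toℕ i) zero ⟩
  cPow (toℕ i) (cPow (suc m) zero) ≡⟨ cong (cPow (toℕ i)) cⁿ0≡0 ⟩
  cPow (toℕ i) zero                ≡⟨ cPow-toℕ-zero i ⟩
  i                                ∎
  where
  open ≡-Reasoning
  cⁿ0≡0 : cPow (suc m) zero ≡ zero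
  cⁿ0≡0 with cycleC-cases (cPow {suc m} m zero)
  ... | inj₁ (_ , cⁿ⁰≡0) = cⁿ⁰≡0
  ... | inj₂ cⁿ≡1+cᵐ     =
    ⊥-elim (<-irrefl (trans cⁿ≡1+cᵐ (cong suc (toℕ-cPow-zero m (n<1+n m)))) (toℕ<n (cPow (suc m) zero)))

module _ {m} (π : Permutation′ (suc m)) where

  coset-injective : ∀ j → Injective _≡_ _≡_ (coset π j)
  coset-injective j = iter-injective cycleC cycleC-injective j ∘ Injection.injective (↔⇒↣ π)

  coset-% : ∀ j i → coset π j i ≡ coset π (j % suc m) i
  coset-% j i = cong (π ⟨$⟩ʳ_) (iter-%-period cycleC (cPow-n i) j)

  fixingExponent : ∀ i → ∃[ e ] coset π (toℕ e) i ≡ i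
  fixingExponent i = fromBoundedExponent (reaches-bounded cycleC-injective (cycleC-reaches i (π ⟨$⟩ˡ i)))
    where
    -- Matching on the witness with 'with' instead makes Agda normalise reaches-bounded (out of memory).
    fromBoundedExponent : ∃[ k ] k < suc m × cPow k i ≡ π ⟨$⟩ˡ i → ∃[ e ] coset π (toℕ e) i ≡ i
    fromBoundedExponent (k , k<n , cᵏi≡π⁻¹i) = fromℕ< k<n , (begin
      coset π (toℕ (fromℕ< k<n)) i ≡⟨ cong (λ k → coset π k i) (toℕ-fromℕ< k<n) ⟩
      coset π k i                  ≡⟨ cong (π ⟨$⟩ʳ_) cᵏi≡π⁻¹i ⟩
      π ⟨$⟩ʳ (π ⟨$⟩ˡ i)             ≡⟨ inverseʳ π ⟩
      i                            ∎)
      where open ≡-Reasoning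

  module _ (2<n : 2 < suc m) (cyc≤2 : ∀ j → cyc (coset π j) ≤ 2) where

    fixingExponent-injective : Injective _≡_ _≡_ (proj₁ ∘ fixingExponent)
    fixingExponent-injective {x} {y} eₓ≡eᵧ =
      fixedPoint-unique {f = coset π k} (coset-injective k) (cyc≤2 k) 2<n (proj₂ (fixingExponent x))
        (subst (λ e → coset π (toℕ e) y ≡ y) (sym eₓ≡eᵧ) (proj₂ (fixingExponent y)))
      where
      k : ℕ
      k = toℕ (proj₁ (fixingExponent x))

    cosetElement-fixedPoint : ∀ j → ∃[ p ] coset π j p ≡ p
    cosetElement-fixedPoint j = fixedPoint (injective⇒surjective fixingExponent-injective j%n)
      where
      j%n : Fin (suc m)
      j%n = fromℕ< (m%n<n j (suc m))
      fixedPoint : ∃[ p ] proj₁ (fixingExponent p) ≡ j%n → ∃[ p ] coset π j p ≡ p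
      fixedPoint (p , eₚ≡j%n) = p , (begin
        coset π j p                                 ≡⟨ coset-% j p ⟩
        coset π (j % suc m) p                       ≡⟨ cong (λ k → coset π k p) (trans (cong toℕ eₚ≡j%n) (toℕ-fromℕ< _)) ⟨
        coset π (toℕ (proj₁ (fixingExponent p))) p ≡⟨ proj₂ (fixingExponent p) ⟩
        p                                           ∎)
        where open ≡-Reasoning

lemma3p5 : (n : ℕ) → 2 < n → (π : Permutation′ n)
         → (∀ j → cyc (coset π j) ≤ 2)
         → Σ ℕ (λ j → cyc (coset π j) ≡ 2)
         → ∀ j → CycleType[n-1,1] (coset π j)
lemma3p5 (suc m) 2<n π cyc≤2 _ j =
  fixedPoint⇒cycleType {f = coset π j} (coset-injective π j) (cyc≤2 j)
    (proj₂ (cosetElement-fixedPoint π 2<n cyc≤2 j))
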